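{- The calculus $\mathsf{Gb}$ is decidable: there is an algorithm which, given any sequent $\Gamma\Rightarrow\alpha$, decides whether $\vdash_{\mathsf{Gb}}\Gamma\Rightarrow\alpha$.
   Context: Formulas of $\mathsf{Gb}$: variables $p$, the constant $\bot$, and $\alpha\cdot\beta$, $\alpha\backslash\beta$, $\alpha\wedge\beta$, $\alpha\vee\beta$, $\alpha\ast\beta$, $\alpha\rightarrow\beta$. Formula structures: every formula is a structure, and if $\Gamma,\Delta$ are structures so are $(\Gamma,\Delta)$ and $(\Gamma;\Delta)$. A context $\Gamma[-]$ is a structure with one designated hole; $\Gamma[\Delta]$ is the result of filling it with $\Delta$. A sequent is $\Gamma\Rightarrow\alpha$ with $\Gamma$ a structure and $\alpha$ a formula. Rules of $\mathsf{Gb}$ (premises / conclusion): $(\mathrm{Id})$ $\alpha\Rightarrow\alpha$; $(\cdot\mathrm{L})$ $\Gamma[\alpha,\beta]\Rightarrow\gamma$ / $\Gamma[\alpha\cdot\beta]\Rightarrow\gamma$; $(\cdot\mathrm{R})$ $\Gamma_1\Rightarrow\alpha$, $\Gamma_2\Rightarrow\beta$ / $\Gamma_1,\Gamma_2\Rightarrow\alpha\cdot\beta$; $(\ast\mathrm{L})$ $\Gamma[\alpha;\beta]\Rightarrow\gamma$ / $\Gamma[\alpha\ast\beta]\Rightarrow\gamma$; $(\ast\mathrm{R})$ $\Gamma_1\Rightarrow\alpha$, $\Gamma_2\Rightarrow\beta$ / $\Gamma_1;\Gamma_2\Rightarrow\alpha\ast\beta$; $(\backslash\mathrm{L})$ $\Delta\Rightarrow\alpha$,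 $\Gamma[\beta]\Rightarrow\gamma$ / $\Gamma[\Delta,\alpha\backslash\beta]\Rightarrow\gamma$; $(\backslash\mathrm{R})$ $\alpha,\Gamma\Rightarrow\beta$ / $\Gamma\Rightarrow\alpha\backslash\beta$; $(\rightarrow\mathrm{L})$ $\Delta\Rightarrow\alpha$, $\Gamma[\beta]\Rightarrow\gamma$ / $\Gamma[\Delta;\alpha\rightarrow\beta]\Rightarrow\gamma$; $(\rightarrow\mathrm{R})$ $\alpha;\Gamma\Rightarrow\beta$ / $\Gamma\Rightarrow\alpha\rightarrow\beta$; $(\wedge\mathrm{L})$ $\Gamma[\alpha]\Rightarrow\beta$ / $\Gamma[\alpha\wedge\gamma]\Rightarrow\beta$ and $\Gamma[\alpha]\Rightarrow\beta$ / $\Gamma[\gamma\wedge\alpha]\Rightarrow\beta$; $(\wedge\mathrm{R})$ $\Gamma\Rightarrow\alpha$, $\Gamma\Rightarrow\beta$ / $\Gamma\Rightarrow\alpha\wedge\beta$; $(\vee\mathrm{L})$ $\Gamma[\alpha]\Rightarrow\gamma$, $\Gamma[\beta]\Rightarrow\gamma$ / $\Gamma[\alpha\vee\beta]\Rightarrow\gamma$; $(\vee\mathrm{R})$ $\Gamma\Rightarrow\alpha$ / $\Gamma\Rightarrow\alpha\vee\beta$ and $\Gamma\Rightarrow\alpha$ / $\Gamma\Rightarrow\beta\vee\alpha$; $(\bot)$ $\Delta\Rightarrow\bot$ / $\Gamma[\Delta]\Rightarrow\alpha$; $(\mathrm{Cut})$ $\Delta\Rightarrow\alpha$, $\Gamma[\alpha]\Rightarrow\beta$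 / $\Gamma[\Delta]\Rightarrow\beta$; $(\mathrm{R}\text{ - }\bot)$ $(\Delta_1,\Delta_2);\Delta_3\Rightarrow\bot$ / $(\Delta_1,\Delta_3);\Delta_2\Rightarrow\bot$; $(\mathrm{Ex})$ $\Gamma[\Delta_1,\Delta_2]\Rightarrow\beta$ / $\Gamma[\Delta_2,\Delta_1]\Rightarrow\beta$; $(\mathrm{Ex}^;)$ $\Gamma[\Delta_1;\Delta_2]\Rightarrow\beta$ / $\Gamma[\Delta_2;\Delta_1]\Rightarrow\beta$; $(\mathrm{As}_1)$ $\Gamma[\Delta_1,(\Delta_2,\Delta_3)]\Rightarrow\beta$ / $\Gamma[(\Delta_1,\Delta_2),\Delta_3]\Rightarrow\beta$; $(\mathrm{As}_2)$ the converse of $(\mathrm{As}_1)$. -}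

module Defs where

open import Data.Nat using (ℕ)

infixr 30 _·_ _∗_
infixr 25 _∧_ _∨_
infixr 20 _╲_ _⟶_

data Fm : Set where
  var  : ℕ → Fm
  ⊥f   : Fm
  _·_  : Fm → Fm → Fm
  _╲_  : Fm → Fm → Fm
  _∧_  : Fm → Fm → Fm
  _∨_  : Fm → Fm → Fm
  _∗_  : Fm → Fm → Fm
  _⟶_  : Fm → Fm → Fm

data Str : Set where
  fm   : Fm → Str
  _,,_ : Str → Str → Str
  _⨾_  : Str → Str → Str

data Ctx : Set where
  hole : Ctx
  _,,ₗ_ : Ctx → Str → Ctx
  _,,ᵣ_ : Str → Ctx → Ctx
  _⨾ₗ_  : Ctx → Str → Ctx
  _⨾ᵣ_  : Str → Ctx → Ctx

_[_] : Ctx → Str → Str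
hole      [ Δ ] = Δ
(Γ ,,ₗ Σ) [ Δ ] = (Γ [ Δ ]) ,, Σ
(Σ ,,ᵣ Γ) [ Δ ] = Σ ,, (Γ [ Δ ])
(Γ ⨾ₗ Σ)  [ Δ ] = (Γ [ Δ ]) ⨾ Σ
(Σ ⨾ᵣ Γ)  [ Δ ] = Σ ⨾ (Γ [ Δ ])

infix 5 _⊢_
data _⊢_ : Str → Fm → Set where
  Id   : ∀ {α} → fm α ⊢ α
  ·L   : ∀ {Γ α β γ} → Γ [ fm α ,, fm β ] ⊢ γ → Γ [ fm (α · β) ] ⊢ γ
  ·R   : ∀ {Γ₁ Γ₂ α β} → Γ₁ ⊢ α → Γ₂ ⊢ β → (Γ₁ ,, Γ₂) ⊢ α · β
  ∗L   : ∀ {Γ α β γ} → Γ [ fm α ⨾ fm β ] ⊢ γ → Γ [ fm (α ∗ β) ] ⊢ γ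
  ∗R   : ∀ {Γ₁ Γ₂ α β} → Γ₁ ⊢ α → Γ₂ ⊢ β → (Γ₁ ⨾ Γ₂) ⊢ α ∗ β
  ╲L   : ∀ {Γ Δ α β γ} → Δ ⊢ α → Γ [ fm β ] ⊢ γ → Γ [ Δ ,, fm (α ╲ β) ] ⊢ γ
  ╲R   : ∀ {Γ α β} → (fm α ,, Γ) ⊢ β → Γ ⊢ α ╲ β
  ⟶L   : ∀ {Γ Δ α β γ} → Δ ⊢ α → Γ [ fm β ] ⊢ γ → Γ [ Δ ⨾ fm (α ⟶ β) ] ⊢ γ
  ⟶R   : ∀ {Γ α β} → (fm α ⨾ Γ) ⊢ β → Γ ⊢ α ⟶ β
  ∧L₁  : ∀ {Γ α β γ} → Γ [ fm α ] ⊢ β → Γ [ fm (α ∧ γ) ] ⊢ β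
  ∧L₂  : ∀ {Γ α β γ} → Γ [ fm α ] ⊢ β → Γ [ fm (γ ∧ α) ] ⊢ β
  ∧R   : ∀ {Γ α β} → Γ ⊢ α → Γ ⊢ β → Γ ⊢ α ∧ β
  ∨L   : ∀ {Γ α β γ} → Γ [ fm α ] ⊢ γ → Γ [ fm β ] ⊢ γ → Γ [ fm (α ∨ β) ] ⊢ γ
  ∨R₁  : ∀ {Γ α β} → Γ ⊢ α → Γ ⊢ α ∨ β
  ∨R₂  : ∀ {Γ α β} → Γ ⊢ α → Γ ⊢ β ∨ α
  ⊥R   : ∀ {Γ Δ α} → Δ ⊢ ⊥f → Γ [ Δ ] ⊢ α
  Cut  : ∀ {Γ Δ α β} → Δ ⊢ α → Γ [ fm α ] ⊢ β → Γ [ Δ ] ⊢ β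
  R-⊥  : ∀ {Δ₁ Δ₂ Δ₃} → ((Δ₁ ,, Δ₂) ⨾ Δ₃) ⊢ ⊥f → ((Δ₁ ,, Δ₃) ⨾ Δ₂) ⊢ ⊥f
  Ex   : ∀ {Γ Δ₁ Δ₂ β} → Γ [ Δ₁ ,, Δ₂ ] ⊢ β → Γ [ Δ₂ ,, Δ₁ ] ⊢ β
  Ex⨾  : ∀ {Γ Δ₁ Δ₂ β} → Γ [ Δ₁ ⨾ Δ₂ ] ⊢ β → Γ [ Δ₂ ⨾ Δ₁ ] ⊢ β
  As₁  : ∀ {Γ Δ₁ Δ₂ Δ₃ β} → Γ [ Δ₁ ,, (Δ₂ ,, Δ₃) ] ⊢ β → Γ [ (Δ₁ ,, Δ₂) ,, Δ₃ ] ⊢ β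
  As₂  : ∀ {Γ Δ₁ Δ₂ Δ₃ β} → Γ [ (Δ₁ ,, Δ₂) ,, Δ₃ ] ⊢ β → Γ [ Δ₁ ,, (Δ₂ ,, Δ₃) ] ⊢ β

{-# OPTIONS --safe #-}
-- Cut is admissible in the cut-free part of Gb (induction on the cut formula, then on the two
-- derivations), so it suffices to decide cut-free derivability. In every cut-free rule the
-- premises have no more subformula occurrences, counted with multiplicity, than the conclusion,
-- and only subformulas of the conclusion or ⊥. So a cut-free derivation of s₀ lives in a finite
-- set of sequents determined by s₀. Within it, the sequents derivable by trees of height k form
-- an increasing chain; once a stage adds nothing it stays constant, and this happens within as
-- many stages as the set has elements, so derivability of s₀ is decided at that stage.
module Submission where

open import Defs
open import Data.Empty using (⊥)
open import Data.List using (List; []; _∷_; _++_; length; map; concatMap; cartesianProduct; filter)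
open import Data.List.Membership.Propositional using (_∈_)
open import Data.List.Membership.Propositional.Properties
  using (∈-++⁺ˡ; ∈-++⁺ʳ; ∈-++⁻; ∈-map⁺; ∈-concatMap⁺; ∈-cartesianProduct⁺)
open import Data.List.Properties using (length-++; length-++-≤ˡ; length-++-≤ʳ; ++-assoc; length-filter)
open import Data.List.Relation.Binary.Subset.Propositional using (_⊆_)
open import Data.List.Relation.Binary.Subset.Propositional.Properties
  using (⊆-refl; ⊆-trans; ⊆-reflexive-↭; xs⊆x∷xs; xs⊆xs++ys; xs⊆ys++xs; ∷⁺ʳ)
  renaming (++⁺ to ⊆-++⁺)
open import Data.List.Relation.Binary.Permutation.Propositional using (_↭_; ↭-trans; ↭-reflexive)
open import Data.List.Relation.Binary.Permutation.Propositional.Properties using (↭-length; ++-comm)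
  renaming (++⁺ˡ to ↭-++⁺ˡ; ++⁺ʳ to ↭-++⁺ʳ)
open import Data.List.Relation.Unary.All as All using (All; []; _∷_; all?)
open import Data.List.Relation.Unary.All.Properties using (¬All⇒Any¬)
open import Data.List.Relation.Unary.Any as Any using (Any; here; there; any?)
open import Data.Nat as ℕ using (ℕ; zero; suc; _+_; _≤_; _<_; z≤n; s≤s; s≤s⁻¹; _⊔_)
open import Data.Nat.Properties
  using ( ≤-refl; ≤-trans; ≤-reflexive; <-≤-trans; n≮n; n≤1+n; m≤n⇒m≤1+n; m≤m⊔n; m≤n⊔m; m<m+n; m<n+m
        ; +-mono-≤; +-monoʳ-≤)
open import Data.Product using (Σ; ∃; _×_; _,_; proj₁; proj₂)
open import Data.Sum using (_⊎_; inj₁; inj₂)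
open import Function using (_∘_)
open import Relation.Binary.Definitions using (DecidableEquality)
open import Relation.Binary.PropositionalEquality using (_≡_; refl; cong; cong₂; sym; trans; subst)
open import Relation.Nullary using (Dec; yes; no; ¬_; contradiction)
open import Relation.Nullary.Decidable using (map′; _×-dec_; _→-dec_)
open import Relation.Unary using (Decidable)

module _ {A : Set} {P Q : A → Set} (P? : Decidable P) (Q? : Decidable Q) (P⊆Q : ∀ {x} → P x → Q x) where

  filter-length-mono : ∀ xs → length (filter P? xs) ≤ length (filter Q? xs)
  filter-length-mono [] = z≤n
  filter-length-mono (x ∷ xs) with P? x | Q? x
  ... | yes _ | yes _  = s≤s (filter-length-mono xs)
  ... | no _  | yes _  = m≤n⇒m≤1+n (filter-length-mono xs)
  ... | no _  | no _   = filter-length-mono xs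
  ... | yes p | no ¬q  = contradiction (P⊆Q p) ¬q

  filter-length-strict : ∀ {xs} → Any (λ x → Q x × ¬ P x) xs → length (filter P? xs) < length (filter Q? xs)
  filter-length-strict {x ∷ xs} (here (q , ¬p)) with P? x | Q? x
  ... | yes p | _      = contradiction p ¬p
  ... | no _  | yes _  = s≤s (filter-length-mono xs)
  ... | no _  | no ¬q  = contradiction q ¬q
  filter-length-strict {x ∷ xs} (there any) with P? x | Q? x
  ... | yes _ | yes _  = s≤s (filter-length-strict any)
  ... | no _  | yes _  = m≤n⇒m≤1+n (filter-length-strict any)
  ... | no _  | no _   = filter-length-strict any
  ... | yes p | no ¬q  = contradiction (P⊆Q p) ¬q

↭-rotate : ∀ {A : Set} (xs ys zs : List A) → (xs ++ ys) ++ zs ↭ ys ++ (xs ++ zs)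
↭-rotate xs ys zs = ↭-trans (↭-++⁺ʳ zs (++-comm xs ys)) (↭-reflexive (++-assoc ys xs zs))

↭-swap-tail : ∀ {A : Set} (xs ys zs : List A) → (xs ++ ys) ++ zs ↭ (xs ++ zs) ++ ys
↭-swap-tail xs ys zs =
  ↭-trans (↭-reflexive (++-assoc xs ys zs)) (↭-trans (↭-++⁺ˡ xs (++-comm ys zs)) (↭-reflexive (sym (++-assoc xs zs ys))))

module Saturation {A : Set} {Rule : A → Set}
                  (premises : ∀ {a} → Rule a → List A) (rules : (a : A) → List (Rule a)) where

  Derivable : ℕ → A → Set
  Derivable zero    _ = ⊥
  Derivable (suc k) a = Any (All (Derivable k) ∘ premises) (rules a)

  derivable? : ∀ k → Decidable (Derivable k)
  derivable? zero    _ = no λ ()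
  derivable? (suc k) a = any? (all? (derivable? k) ∘ premises) (rules a)

  Derivable-mono : ∀ {k m} → k ≤ m → ∀ {a} → Derivable k a → Derivable m a
  Derivable-mono {zero}              _          ()
  Derivable-mono {suc k} {suc m} (s≤s k≤m) d  = Any.map (All.map (Derivable-mono k≤m)) d

  Derivable-sound : (P : A → Set) → (∀ {a} (r : Rule a) → All P (premises r) → P a) → ∀ k {a} → Derivable k a → P a
  Derivable-sound P closed zero    ()
  Derivable-sound P closed (suc k) d with Any.satisfied d
  ... | r , ds = closed r (All.map (Derivable-sound P closed k) ds)

  common-height : ∀ {as} → All (λ a → ∃ λ k → Derivable k a) as → ∃ λ k → All (Derivable k) as
  common-height [] = 0 , []
  common-height ((k , d) ∷ ds) with common-height ds
  ... | m , ds′ = k ⊔ m , Derivable-mono (m≤m⊔n k m) d ∷ All.map (Derivable-mono (m≤n⊔m k m)) ds′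

  derivable-by : ∀ {a r} → r ∈ rules a → All (λ p → ∃ λ k → Derivable k p) (premises r) → ∃ λ k → Derivable k a
  derivable-by r∈ ds with common-height ds
  ... | k , ds′ = suc k , Any.map (λ { refl → ds′ }) r∈

  module Stabilisation {Inside : A → Set} (closed : ∀ {a} → Inside a → (r : Rule a) → All Inside (premises r))
                       (universe : List A) (∈-universe : ∀ {a} → Inside a → a ∈ universe) where

    Stable : ℕ → Set
    Stable k = ∀ {a} → Inside a → Derivable (suc k) a → Derivable k a

    stable-forever : ∀ {k} → Stable k → ∀ m {a} → Inside a → Derivable m a → Derivable k a
    stable-forever st zero    _    ()
    stable-forever st (suc m) {a} in-a d = st in-a (Any.map (λ {r} ds → lower (closed in-a r) ds) d)
      where
      lower : ∀ {ps} → All Inside ps → All (Derivable m) ps → All (Derivable _) ps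
      lower [] [] = []
      lower (i ∷ is) (d ∷ ds) = stable-forever st m i d ∷ lower is ds

    derivable-count : ℕ → ℕ
    derivable-count k = length (filter (derivable? k) universe)

    settled? : ∀ {k} → Decidable (λ a → Derivable (suc k) a → Derivable k a)
    settled? {k} a = derivable? (suc k) a →-dec derivable? k a

    stable-or-growing : ∀ k → ∃ Stable ⊎ k ≤ derivable-count k
    stable-or-growing zero = inj₂ z≤n
    stable-or-growing (suc k) with stable-or-growing k
    ... | inj₁ st = inj₁ st
    ... | inj₂ k≤count with all? settled? universe
    ...   | yes st = inj₁ (k , λ in-a → All.lookup st (∈-universe in-a))
    ...   | no ¬st = inj₂ (≤-trans (s≤s k≤count) (filter-length-strict (derivable? k) (derivable? (suc k))
                              (Derivable-mono (m≤n⇒m≤1+n (≤-refl {k}))) (Any.map newly-derivable (¬All⇒Any¬ settled? universe ¬st))))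
      where
      newly-derivable : ∀ {a} → ¬ (Derivable (suc k) a → Derivable k a) → Derivable (suc k) a × ¬ Derivable k a
      newly-derivable {a} ¬step with derivable? (suc k) a | derivable? k a
      ... | _     | yes d = contradiction (λ _ → d) ¬step
      ... | yes d | no ¬d = d , ¬d
      ... | no ¬d | no _  = contradiction (λ d → contradiction d ¬d) ¬step

    stable-exists : ∃ Stable
    stable-exists with stable-or-growing (suc (length universe))
    ... | inj₁ st = st
    ... | inj₂ big = contradiction (≤-trans big (length-filter (derivable? (suc (length universe))) universe)) (n≮n _)

_∘ᶜ_ : Ctx → Ctx → Ctx
hole      ∘ᶜ D = D
(C ,,ₗ Σ) ∘ᶜ D = (C ∘ᶜ D) ,,ₗ Σ
(Σ ,,ᵣ C) ∘ᶜ D = Σ ,,ᵣ (C ∘ᶜ D)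
(C ⨾ₗ Σ)  ∘ᶜ D = (C ∘ᶜ D) ⨾ₗ Σ
(Σ ⨾ᵣ C)  ∘ᶜ D = Σ ⨾ᵣ (C ∘ᶜ D)

plug-∘ᶜ : ∀ C D X → (C ∘ᶜ D) [ X ] ≡ C [ D [ X ] ]
plug-∘ᶜ hole      D X = refl
plug-∘ᶜ (C ,,ₗ Σ) D X = cong (_,, Σ) (plug-∘ᶜ C D X)
plug-∘ᶜ (Σ ,,ᵣ C) D X = cong (Σ ,,_) (plug-∘ᶜ C D X)
plug-∘ᶜ (C ⨾ₗ Σ)  D X = cong (_⨾ Σ) (plug-∘ᶜ C D X)
plug-∘ᶜ (Σ ⨾ᵣ C)  D X = cong (Σ ⨾_) (plug-∘ᶜ C D X)

-- Two-hole contexts: ,,₁₂ A B is A[hole₁] ,, B[hole₂], and ,,₂₁ A B is A[hole₂] ,, B[hole₁].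
data Ctx₂ : Set where
  ,,₁₂ ,,₂₁ ⨾₁₂ ⨾₂₁ : Ctx → Ctx → Ctx₂
  _,,ₗ₂_ _⨾ₗ₂_ : Ctx₂ → Str → Ctx₂
  _,,ᵣ₂_ _⨾ᵣ₂_ : Str → Ctx₂ → Ctx₂

fill₁ : Ctx₂ → Str → Ctx
fill₁ (,,₁₂ A B) Y = (A [ Y ]) ,,ᵣ B
fill₁ (,,₂₁ A B) Y = A ,,ₗ (B [ Y ])
fill₁ (⨾₁₂ A B)  Y = (A [ Y ]) ⨾ᵣ B
fill₁ (⨾₂₁ A B)  Y = A ⨾ₗ (B [ Y ])
fill₁ (T ,,ₗ₂ Σ) Y = fill₁ T Y ,,ₗ Σ
fill₁ (Σ ,,ᵣ₂ T) Y = Σ ,,ᵣ fill₁ T Y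
fill₁ (T ⨾ₗ₂ Σ)  Y = fill₁ T Y ⨾ₗ Σ
fill₁ (Σ ⨾ᵣ₂ T)  Y = Σ ⨾ᵣ fill₁ T Y

fill₂ : Ctx₂ → Str → Ctx
fill₂ (,,₁₂ A B) Z = A ,,ₗ (B [ Z ])
fill₂ (,,₂₁ A B) Z = (A [ Z ]) ,,ᵣ B
fill₂ (⨾₁₂ A B)  Z = A ⨾ₗ (B [ Z ])
fill₂ (⨾₂₁ A B)  Z = (A [ Z ]) ⨾ᵣ B
fill₂ (T ,,ₗ₂ Σ) Z = fill₂ T Z ,,ₗ Σ
fill₂ (Σ ,,ᵣ₂ T) Z = Σ ,,ᵣ fill₂ T Z
fill₂ (T ⨾ₗ₂ Σ)  Z = fill₂ T Z ⨾ₗ Σ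
fill₂ (Σ ⨾ᵣ₂ T)  Z = Σ ⨾ᵣ fill₂ T Z

fill₁-fill₂ : ∀ T Y Z → fill₁ T Y [ Z ] ≡ fill₂ T Z [ Y ]
fill₁-fill₂ (,,₁₂ A B) Y Z = refl
fill₁-fill₂ (,,₂₁ A B) Y Z = refl
fill₁-fill₂ (⨾₁₂ A B)  Y Z = refl
fill₁-fill₂ (⨾₂₁ A B)  Y Z = refl
fill₁-fill₂ (T ,,ₗ₂ Σ) Y Z = cong (_,, Σ) (fill₁-fill₂ T Y Z)
fill₁-fill₂ (Σ ,,ᵣ₂ T) Y Z = cong (Σ ,,_) (fill₁-fill₂ T Y Z)
fill₁-fill₂ (T ⨾ₗ₂ Σ)  Y Z = cong (_⨾ Σ) (fill₁-fill₂ T Y Z)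
fill₁-fill₂ (Σ ⨾ᵣ₂ T)  Y Z = cong (Σ ⨾_) (fill₁-fill₂ T Y Z)

,,-injective : ∀ {A B A′ B′} → (A ,, B) ≡ (A′ ,, B′) → A ≡ A′ × B ≡ B′
,,-injective refl = refl , refl

⨾-injective : ∀ {A B A′ B′} → (A ⨾ B) ≡ (A′ ⨾ B′) → A ≡ A′ × B ≡ B′
⨾-injective refl = refl , refl

plug-fm : ∀ Γ {α β} → fm α ≡ Γ [ fm β ] → Γ ≡ hole × α ≡ β
plug-fm hole      refl = refl , refl
plug-fm (_ ,,ₗ _) ()
plug-fm (_ ,,ᵣ _) ()
plug-fm (_ ⨾ₗ _)  ()
plug-fm (_ ⨾ᵣ _)  ()

data Position (C : Ctx) (X : Str) (Γ : Ctx) (α : Fm) : Set where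
  inside   : ∀ D → Γ ≡ C ∘ᶜ D → X ≡ D [ fm α ] → Position C X Γ α
  disjoint : ∀ T → C ≡ fill₂ T (fm α) → Γ ≡ fill₁ T X → Position C X Γ α

position : ∀ C X Γ α → C [ X ] ≡ Γ [ fm α ] → Position C X Γ α
position hole X Γ α eq = inside Γ refl eq
position (C ,,ₗ Σ) X hole α ()
position (C ⨾ₗ Σ)  X hole α ()
position (Σ ,,ᵣ C) X hole α ()
position (Σ ⨾ᵣ C)  X hole α ()
position (C ,,ₗ Σ) X (Γ ,,ₗ Σ′) α eq with ,,-injective eq
... | eq′ , refl with position C X Γ α eq′
...   | inside D refl e    = inside D refl e
...   | disjoint T refl refl = disjoint (T ,,ₗ₂ Σ) refl refl
position (C ,,ₗ Σ) X (Σ′ ,,ᵣ Γ) α refl = disjoint (,,₁₂ C Γ) refl refl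
position (Σ ,,ᵣ C) X (Γ ,,ₗ Σ′) α refl = disjoint (,,₂₁ Γ C) refl refl
position (Σ ,,ᵣ C) X (Σ′ ,,ᵣ Γ) α eq with ,,-injective eq
... | refl , eq′ with position C X Γ α eq′
...   | inside D refl e    = inside D refl e
...   | disjoint T refl refl = disjoint (Σ ,,ᵣ₂ T) refl refl
position (C ⨾ₗ Σ) X (Γ ⨾ₗ Σ′) α eq with ⨾-injective eq
... | eq′ , refl with position C X Γ α eq′
...   | inside D refl e    = inside D refl e
...   | disjoint T refl refl = disjoint (T ⨾ₗ₂ Σ) refl refl
position (C ⨾ₗ Σ) X (Σ′ ⨾ᵣ Γ) α refl = disjoint (⨾₁₂ C Γ) refl refl
position (Σ ⨾ᵣ C) X (Γ ⨾ₗ Σ′) α refl = disjoint (⨾₂₁ Γ C) refl refl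
position (Σ ⨾ᵣ C) X (Σ′ ⨾ᵣ Γ) α eq with ⨾-injective eq
... | refl , eq′ with position C X Γ α eq′
...   | inside D refl e    = inside D refl e
...   | disjoint T refl refl = disjoint (Σ ⨾ᵣ₂ T) refl refl
position (C ,,ₗ Σ) X (Γ ⨾ₗ Σ′) α ()
position (C ,,ₗ Σ) X (Σ′ ⨾ᵣ Γ) α ()
position (Σ ,,ᵣ C) X (Γ ⨾ₗ Σ′) α ()
position (Σ ,,ᵣ C) X (Σ′ ⨾ᵣ Γ) α ()
position (C ⨾ₗ Σ)  X (Γ ,,ₗ Σ′) α ()
position (C ⨾ₗ Σ)  X (Σ′ ,,ᵣ Γ) α ()
position (Σ ⨾ᵣ C)  X (Γ ,,ₗ Σ′) α ()
position (Σ ⨾ᵣ C)  X (Σ′ ,,ᵣ Γ) α ()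

infix 5 _⊢cf_

data _⊢cf_ : Str → Fm → Set where
  Id   : ∀ {α} → fm α ⊢cf α
  ·L   : ∀ {Γ α β γ} → Γ [ fm α ,, fm β ] ⊢cf γ → Γ [ fm (α · β) ] ⊢cf γ
  ·R   : ∀ {Γ₁ Γ₂ α β} → Γ₁ ⊢cf α → Γ₂ ⊢cf β → (Γ₁ ,, Γ₂) ⊢cf α · β
  ∗L   : ∀ {Γ α β γ} → Γ [ fm α ⨾ fm β ] ⊢cf γ → Γ [ fm (α ∗ β) ] ⊢cf γ
  ∗R   : ∀ {Γ₁ Γ₂ α β} → Γ₁ ⊢cf α → Γ₂ ⊢cf β → (Γ₁ ⨾ Γ₂) ⊢cf α ∗ β
  ╲L   : ∀ {Γ Δ α β γ} → Δ ⊢cf α → Γ [ fm β ] ⊢cf γ → Γ [ Δ ,, fm (α ╲ β) ] ⊢cf γ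
  ╲R   : ∀ {Γ α β} → (fm α ,, Γ) ⊢cf β → Γ ⊢cf α ╲ β
  ⟶L   : ∀ {Γ Δ α β γ} → Δ ⊢cf α → Γ [ fm β ] ⊢cf γ → Γ [ Δ ⨾ fm (α ⟶ β) ] ⊢cf γ
  ⟶R   : ∀ {Γ α β} → (fm α ⨾ Γ) ⊢cf β → Γ ⊢cf α ⟶ β
  ∧L₁  : ∀ {Γ α β γ} → Γ [ fm α ] ⊢cf β → Γ [ fm (α ∧ γ) ] ⊢cf β
  ∧L₂  : ∀ {Γ α β γ} → Γ [ fm α ] ⊢cf β → Γ [ fm (γ ∧ α) ] ⊢cf β
  ∧R   : ∀ {Γ α β} → Γ ⊢cf α → Γ ⊢cf β → Γ ⊢cf α ∧ β
  ∨L   : ∀ {Γ α β γ} → Γ [ fm α ] ⊢cf γ → Γ [ fm β ] ⊢cf γ → Γ [ fm (α ∨ β) ] ⊢cf γ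
  ∨R₁  : ∀ {Γ α β} → Γ ⊢cf α → Γ ⊢cf α ∨ β
  ∨R₂  : ∀ {Γ α β} → Γ ⊢cf α → Γ ⊢cf β ∨ α
  ⊥R   : ∀ {Γ Δ α} → Δ ⊢cf ⊥f → Γ [ Δ ] ⊢cf α
  R-⊥  : ∀ {Δ₁ Δ₂ Δ₃} → ((Δ₁ ,, Δ₂) ⨾ Δ₃) ⊢cf ⊥f → ((Δ₁ ,, Δ₃) ⨾ Δ₂) ⊢cf ⊥f
  Ex   : ∀ {Γ Δ₁ Δ₂ β} → Γ [ Δ₁ ,, Δ₂ ] ⊢cf β → Γ [ Δ₂ ,, Δ₁ ] ⊢cf β
  Ex⨾  : ∀ {Γ Δ₁ Δ₂ β} → Γ [ Δ₁ ⨾ Δ₂ ] ⊢cf β → Γ [ Δ₂ ⨾ Δ₁ ] ⊢cf β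
  As₁  : ∀ {Γ Δ₁ Δ₂ Δ₃ β} → Γ [ Δ₁ ,, (Δ₂ ,, Δ₃) ] ⊢cf β → Γ [ (Δ₁ ,, Δ₂) ,, Δ₃ ] ⊢cf β
  As₂  : ∀ {Γ Δ₁ Δ₂ Δ₃ β} → Γ [ (Δ₁ ,, Δ₂) ,, Δ₃ ] ⊢cf β → Γ [ Δ₁ ,, (Δ₂ ,, Δ₃) ] ⊢cf β

infix 4 _≺_

data _≺_ : Fm → Fm → Set where
  ·₁ : ∀ {a b} → a ≺ a · b
  ·₂ : ∀ {a b} → b ≺ a · b
  ∗₁ : ∀ {a b} → a ≺ a ∗ b
  ∗₂ : ∀ {a b} → b ≺ a ∗ b
  ╲₁ : ∀ {a b} → a ≺ a ╲ b
  ╲₂ : ∀ {a b} → b ≺ a ╲ b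
  ⟶₁ : ∀ {a b} → a ≺ a ⟶ b
  ⟶₂ : ∀ {a b} → b ≺ a ⟶ b
  ∧₁ : ∀ {a b} → a ≺ a ∧ b
  ∧₂ : ∀ {a b} → b ≺ a ∧ b
  ∨₁ : ∀ {a b} → a ≺ a ∨ b
  ∨₂ : ∀ {a b} → b ≺ a ∨ b

-- The equation S ≡ Γ [ fm α ] lets the right premise be matched on freely.
CutAdmissible : Fm → Set
CutAdmissible α = ∀ {Δ S Γ β} → Δ ⊢cf α → S ⊢cf β → S ≡ Γ [ fm α ] → Γ [ Δ ] ⊢cf β

CutAdmissibleBelow : Fm → Set
CutAdmissibleBelow α = ∀ {γ} → γ ≺ α → CutAdmissible γ

data RightIntro : Str → Fm → Set where
  ·R  : ∀ {Γ₁ Γ₂ a b} → Γ₁ ⊢cf a → Γ₂ ⊢cf b → RightIntro (Γ₁ ,, Γ₂) (a · b)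
  ∗R  : ∀ {Γ₁ Γ₂ a b} → Γ₁ ⊢cf a → Γ₂ ⊢cf b → RightIntro (Γ₁ ⨾ Γ₂) (a ∗ b)
  ╲R  : ∀ {Γ a b} → (fm a ,, Γ) ⊢cf b → RightIntro Γ (a ╲ b)
  ⟶R  : ∀ {Γ a b} → (fm a ⨾ Γ) ⊢cf b → RightIntro Γ (a ⟶ b)
  ∧R  : ∀ {Γ a b} → Γ ⊢cf a → Γ ⊢cf b → RightIntro Γ (a ∧ b)
  ∨R₁ : ∀ {Γ a b} → Γ ⊢cf a → RightIntro Γ (a ∨ b)
  ∨R₂ : ∀ {Γ a b} → Γ ⊢cf b → RightIntro Γ (a ∨ b)

fromRightIntro : ∀ {Δ α} → RightIntro Δ α → Δ ⊢cf α
fromRightIntro (·R d e)  = ·R d e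
fromRightIntro (∗R d e)  = ∗R d e
fromRightIntro (╲R d)    = ╲R d
fromRightIntro (⟶R d)    = ⟶R d
fromRightIntro (∧R d e)  = ∧R d e
fromRightIntro (∨R₁ d)   = ∨R₁ d
fromRightIntro (∨R₂ d)   = ∨R₂ d

Rule₁ : Str → Str → Fm → Set
Rule₁ Y X β = ∀ {C} → C [ Y ] ⊢cf β → C [ X ] ⊢cf β

Rule₂ : Str → Str → Str → Fm → Set
Rule₂ Y Z X β = ∀ {C} → C [ Y ] ⊢cf β → C [ Z ] ⊢cf β → C [ X ] ⊢cf β

module _ {β : Fm} where

  at-hole₁ : ∀ {Δ} T X Y → Rule₁ Y X β → fill₁ T Y [ Δ ] ⊢cf β → fill₁ T X [ Δ ] ⊢cf β
  at-hole₁ {Δ} T X Y rule d =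
    subst (_⊢cf β) (sym (fill₁-fill₂ T X Δ)) (rule (subst (_⊢cf β) (fill₁-fill₂ T Y Δ) d))

  at-hole₁² : ∀ {Δ} T X Y Z → Rule₂ Y Z X β → fill₁ T Y [ Δ ] ⊢cf β → fill₁ T Z [ Δ ] ⊢cf β → fill₁ T X [ Δ ] ⊢cf β
  at-hole₁² {Δ} T X Y Z rule d e =
    subst (_⊢cf β) (sym (fill₁-fill₂ T X Δ))
      (rule (subst (_⊢cf β) (fill₁-fill₂ T Y Δ) d) (subst (_⊢cf β) (fill₁-fill₂ T Z Δ) e))

  through-∘ᶜ : ∀ {Δ} C D′ D → (C [ D′ [ Δ ] ] ⊢cf β → C [ D [ Δ ] ] ⊢cf β) → (C ∘ᶜ D′) [ Δ ] ⊢cf β → (C ∘ᶜ D) [ Δ ] ⊢cf β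
  through-∘ᶜ {Δ} C D′ D f d = subst (_⊢cf β) (sym (plug-∘ᶜ C D Δ)) (f (subst (_⊢cf β) (plug-∘ᶜ C D′ Δ) d))

  in-context : ∀ Γ C {X Y} → Rule₁ Y X β → Γ [ C [ Y ] ] ⊢cf β → Γ [ C [ X ] ] ⊢cf β
  in-context Γ C rule d = subst (_⊢cf β) (plug-∘ᶜ Γ C _) (rule (subst (_⊢cf β) (sym (plug-∘ᶜ Γ C _)) d))

  in-context² : ∀ Γ C {X Y Z} → Rule₂ Y Z X β → Γ [ C [ Y ] ] ⊢cf β → Γ [ C [ Z ] ] ⊢cf β → Γ [ C [ X ] ] ⊢cf β
  in-context² Γ C rule d e =
    subst (_⊢cf β) (plug-∘ᶜ Γ C _) (rule (subst (_⊢cf β) (sym (plug-∘ᶜ Γ C _)) d) (subst (_⊢cf β) (sym (plug-∘ᶜ Γ C _)) e))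

refocus₂ : ∀ T Y α → fill₂ T (fm α) [ Y ] ≡ fill₁ T Y [ fm α ]
refocus₂ T Y α = sym (fill₁-fill₂ T Y (fm α))

refocus : ∀ C D α → C [ D [ fm α ] ] ≡ (C ∘ᶜ D) [ fm α ]
refocus C D α = sym (plug-∘ᶜ C D (fm α))

-- Induction on the right premise: where α is principal it meets the right rule that introduced it,
-- and the cut is replaced by cuts on immediate subformulas; elsewhere the cut moves upwards.
cut-right-intro : ∀ α → CutAdmissibleBelow α → ∀ {Δ S Γ β} → RightIntro Δ α → S ⊢cf β → S ≡ Γ [ fm α ] → Γ [ Δ ] ⊢cf β
cut-right-intro α ih {Γ = Γ} r Id eq with plug-fm Γ eq
... | refl , refl = fromRightIntro r
cut-right-intro α ih {Δ} {Γ = Γ} r (·L {C} {a} {b} e) eq with position C (fm (a · b)) Γ α eq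
... | disjoint T refl refl =
  at-hole₁ T (fm (a · b)) (fm a ,, fm b) (λ {C} → ·L {C} {a} {b}) (cut-right-intro α ih r e (refocus₂ T _ α))
... | inside D refl eX with plug-fm D eX
... | refl , refl with r
... | ·R {Γ₁} {Γ₂} d₁ d₂ =
  subst (_⊢cf _) (sym (plug-∘ᶜ C hole _))
    (subst (_⊢cf _) (plug-∘ᶜ C (Γ₁ ,,ᵣ hole) Γ₂)
      (ih ·₂ d₂ (subst (_⊢cf _) (plug-∘ᶜ C (hole ,,ₗ fm b) Γ₁) (ih ·₁ d₁ e (refocus C (hole ,,ₗ fm b) a)))
        (refocus C (Γ₁ ,,ᵣ hole) b)))
cut-right-intro α ih {Δ} {Γ = Γ} r (∗L {C} {a} {b} e) eq with position C (fm (a ∗ b)) Γ α eq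
... | disjoint T refl refl =
  at-hole₁ T (fm (a ∗ b)) (fm a ⨾ fm b) (λ {C} → ∗L {C} {a} {b}) (cut-right-intro α ih r e (refocus₂ T _ α))
... | inside D refl eX with plug-fm D eX
... | refl , refl with r
... | ∗R {Γ₁} {Γ₂} d₁ d₂ =
  subst (_⊢cf _) (sym (plug-∘ᶜ C hole _))
    (subst (_⊢cf _) (plug-∘ᶜ C (Γ₁ ⨾ᵣ hole) Γ₂)
      (ih ∗₂ d₂ (subst (_⊢cf _) (plug-∘ᶜ C (hole ⨾ₗ fm b) Γ₁) (ih ∗₁ d₁ e (refocus C (hole ⨾ₗ fm b) a)))
        (refocus C (Γ₁ ⨾ᵣ hole) b)))
cut-right-intro α ih {Δ} {Γ = Γ} r (╲L {C} {Δ′} {a} {b} e₁ e₂) eq with position C (Δ′ ,, fm (a ╲ b)) Γ α eq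
... | disjoint T refl refl =
  at-hole₁ T (Δ′ ,, fm (a ╲ b)) (fm b) (λ {C} → ╲L {C} {Δ′} {a} {b} e₁) (cut-right-intro α ih r e₂ (refocus₂ T _ α))
... | inside hole refl ()
... | inside (D ⨾ₗ _) refl ()
... | inside (_ ⨾ᵣ D) refl ()
... | inside (D ,,ₗ _) refl refl =
  subst (_⊢cf _) (sym (plug-∘ᶜ C (D ,,ₗ fm (a ╲ b)) Δ)) (╲L {C} (cut-right-intro α ih r e₁ refl) e₂)
... | inside (_ ,,ᵣ D) refl eX with ,,-injective eX
... | refl , eX₂ with plug-fm D eX₂
... | refl , refl with r
... | ╲R {G} d = subst (_⊢cf _) (sym (plug-∘ᶜ C (Δ′ ,,ᵣ hole) G)) (ih ╲₂ {Γ = C} (ih ╲₁ {Γ = hole ,,ₗ G} e₁ d refl) e₂ refl)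
cut-right-intro α ih {Δ} {Γ = Γ} r (⟶L {C} {Δ′} {a} {b} e₁ e₂) eq with position C (Δ′ ⨾ fm (a ⟶ b)) Γ α eq
... | disjoint T refl refl =
  at-hole₁ T (Δ′ ⨾ fm (a ⟶ b)) (fm b) (λ {C} → ⟶L {C} {Δ′} {a} {b} e₁) (cut-right-intro α ih r e₂ (refocus₂ T _ α))
... | inside hole refl ()
... | inside (D ,,ₗ _) refl ()
... | inside (_ ,,ᵣ D) refl ()
... | inside (D ⨾ₗ _) refl refl =
  subst (_⊢cf _) (sym (plug-∘ᶜ C (D ⨾ₗ fm (a ⟶ b)) Δ)) (⟶L {C} (cut-right-intro α ih r e₁ refl) e₂)
... | inside (_ ⨾ᵣ D) refl eX with ⨾-injective eX
... | refl , eX₂ with plug-fm D eX₂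
... | refl , refl with r
... | ⟶R {G} d = subst (_⊢cf _) (sym (plug-∘ᶜ C (Δ′ ⨾ᵣ hole) G)) (ih ⟶₂ {Γ = C} (ih ⟶₁ {Γ = hole ⨾ₗ G} e₁ d refl) e₂ refl)
cut-right-intro α ih {Δ} {Γ = Γ} r (∧L₁ {C} {a} {_} {c} e) eq with position C (fm (a ∧ c)) Γ α eq
... | disjoint T refl refl =
  at-hole₁ T (fm (a ∧ c)) (fm a) (λ {C} → ∧L₁ {C} {a} {_} {c}) (cut-right-intro α ih r e (refocus₂ T _ α))
... | inside D refl eX with plug-fm D eX
... | refl , refl with r
... | ∧R d₁ d₂ = subst (_⊢cf _) (sym (plug-∘ᶜ C hole _)) (ih ∧₁ {Γ = C} d₁ e refl)
cut-right-intro α ih {Δ} {Γ = Γ} r (∧L₂ {C} {a} {_} {c} e) eq with position C (fm (c ∧ a)) Γ α eq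
... | disjoint T refl refl =
  at-hole₁ T (fm (c ∧ a)) (fm a) (λ {C} → ∧L₂ {C} {a} {_} {c}) (cut-right-intro α ih r e (refocus₂ T _ α))
... | inside D refl eX with plug-fm D eX
... | refl , refl with r
... | ∧R d₁ d₂ = subst (_⊢cf _) (sym (plug-∘ᶜ C hole _)) (ih ∧₂ {Γ = C} d₂ e refl)
cut-right-intro α ih {Δ} {Γ = Γ} r (∨L {C} {a} {b} e₁ e₂) eq with position C (fm (a ∨ b)) Γ α eq
... | disjoint T refl refl =
  at-hole₁² T (fm (a ∨ b)) (fm a) (fm b) (λ {C} → ∨L {C} {a} {b})
    (cut-right-intro α ih r e₁ (refocus₂ T _ α)) (cut-right-intro α ih r e₂ (refocus₂ T _ α))
... | inside D refl eX with plug-fm D eX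
... | refl , refl with r
... | ∨R₁ d = subst (_⊢cf _) (sym (plug-∘ᶜ C hole _)) (ih ∨₁ {Γ = C} d e₁ refl)
... | ∨R₂ d = subst (_⊢cf _) (sym (plug-∘ᶜ C hole _)) (ih ∨₂ {Γ = C} d e₂ refl)
cut-right-intro α ih {Δ} {Γ = Γ} r (⊥R {C} {Δ′} e) eq with position C Δ′ Γ α eq
... | disjoint T refl refl = subst (_⊢cf _) (sym (fill₁-fill₂ T Δ′ Δ)) (⊥R {fill₂ T Δ} e)
... | inside D refl refl = subst (_⊢cf _) (sym (plug-∘ᶜ C D Δ)) (⊥R {C} (cut-right-intro α ih r e refl))
cut-right-intro α ih {Δ} {Γ = Γ} r (Ex {C} {Δ₂} {Δ₁} e) eq with position C (Δ₁ ,, Δ₂) Γ α eq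
... | disjoint T refl refl =
  at-hole₁ T (Δ₁ ,, Δ₂) (Δ₂ ,, Δ₁) (λ {C} → Ex {C} {Δ₂} {Δ₁}) (cut-right-intro α ih r e (refocus₂ T _ α))
... | inside hole refl ()
... | inside (D ⨾ₗ _) refl ()
... | inside (_ ⨾ᵣ D) refl ()
... | inside (D ,,ₗ s) refl refl = through-∘ᶜ C (s ,,ᵣ D) (D ,,ₗ s) (Ex {C}) (cut-right-intro α ih r e (refocus C (s ,,ᵣ D) α))
... | inside (s ,,ᵣ D) refl refl = through-∘ᶜ C (D ,,ₗ s) (s ,,ᵣ D) (Ex {C}) (cut-right-intro α ih r e (refocus C (D ,,ₗ s) α))
cut-right-intro α ih {Δ} {Γ = Γ} r (Ex⨾ {C} {Δ₂} {Δ₁} e) eq with position C (Δ₁ ⨾ Δ₂) Γ α eq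
... | disjoint T refl refl =
  at-hole₁ T (Δ₁ ⨾ Δ₂) (Δ₂ ⨾ Δ₁) (λ {C} → Ex⨾ {C} {Δ₂} {Δ₁}) (cut-right-intro α ih r e (refocus₂ T _ α))
... | inside hole refl ()
... | inside (D ,,ₗ _) refl ()
... | inside (_ ,,ᵣ D) refl ()
... | inside (D ⨾ₗ s) refl refl = through-∘ᶜ C (s ⨾ᵣ D) (D ⨾ₗ s) (Ex⨾ {C}) (cut-right-intro α ih r e (refocus C (s ⨾ᵣ D) α))
... | inside (s ⨾ᵣ D) refl refl = through-∘ᶜ C (D ⨾ₗ s) (s ⨾ᵣ D) (Ex⨾ {C}) (cut-right-intro α ih r e (refocus C (D ⨾ₗ s) α))
cut-right-intro α ih {Δ} {Γ = Γ} r (As₁ {C} {Δ₁} {Δ₂} {Δ₃} e) eq with position C ((Δ₁ ,, Δ₂) ,, Δ₃) Γ α eq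
... | disjoint T refl refl =
  at-hole₁ T ((Δ₁ ,, Δ₂) ,, Δ₃) (Δ₁ ,, (Δ₂ ,, Δ₃)) (λ {C} → As₁ {C} {Δ₁} {Δ₂} {Δ₃}) (cut-right-intro α ih r e (refocus₂ T _ α))
... | inside hole refl ()
... | inside (D ⨾ₗ _) refl ()
... | inside (_ ⨾ᵣ D) refl ()
... | inside (hole ,,ₗ _) refl ()
... | inside ((D ⨾ₗ _) ,,ₗ _) refl ()
... | inside ((_ ⨾ᵣ D) ,,ₗ _) refl ()
... | inside ((D ,,ₗ s₂) ,,ₗ s₃) refl refl =
  through-∘ᶜ C (D ,,ₗ (s₂ ,, s₃)) ((D ,,ₗ s₂) ,,ₗ s₃) (As₁ {C}) (cut-right-intro α ih r e (refocus C (D ,,ₗ (s₂ ,, s₃)) α))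
... | inside ((s₁ ,,ᵣ D) ,,ₗ s₃) refl refl =
  through-∘ᶜ C (s₁ ,,ᵣ (D ,,ₗ s₃)) ((s₁ ,,ᵣ D) ,,ₗ s₃) (As₁ {C}) (cut-right-intro α ih r e (refocus C (s₁ ,,ᵣ (D ,,ₗ s₃)) α))
... | inside (s₁₂ ,,ᵣ D) refl refl =
  through-∘ᶜ C (Δ₁ ,,ᵣ (Δ₂ ,,ᵣ D)) (s₁₂ ,,ᵣ D) (As₁ {C}) (cut-right-intro α ih r e (refocus C (Δ₁ ,,ᵣ (Δ₂ ,,ᵣ D)) α))
cut-right-intro α ih {Δ} {Γ = Γ} r (As₂ {C} {Δ₁} {Δ₂} {Δ₃} e) eq with position C (Δ₁ ,, (Δ₂ ,, Δ₃)) Γ α eq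
... | disjoint T refl refl =
  at-hole₁ T (Δ₁ ,, (Δ₂ ,, Δ₃)) ((Δ₁ ,, Δ₂) ,, Δ₃) (λ {C} → As₂ {C} {Δ₁} {Δ₂} {Δ₃}) (cut-right-intro α ih r e (refocus₂ T _ α))
... | inside hole refl ()
... | inside (D ⨾ₗ _) refl ()
... | inside (_ ⨾ᵣ D) refl ()
... | inside (_ ,,ᵣ hole) refl ()
... | inside (_ ,,ᵣ (D ⨾ₗ _)) refl ()
... | inside (_ ,,ᵣ (_ ⨾ᵣ D)) refl ()
... | inside (D ,,ₗ s₂₃) refl refl =
  through-∘ᶜ C ((D ,,ₗ Δ₂) ,,ₗ Δ₃) (D ,,ₗ s₂₃) (As₂ {C}) (cut-right-intro α ih r e (refocus C ((D ,,ₗ Δ₂) ,,ₗ Δ₃) α))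
... | inside (s₁ ,,ᵣ (D ,,ₗ s₃)) refl refl =
  through-∘ᶜ C ((s₁ ,,ᵣ D) ,,ₗ s₃) (s₁ ,,ᵣ (D ,,ₗ s₃)) (As₂ {C}) (cut-right-intro α ih r e (refocus C ((s₁ ,,ᵣ D) ,,ₗ s₃) α))
... | inside (s₁ ,,ᵣ (s₂ ,,ᵣ D)) refl refl =
  through-∘ᶜ C ((s₁ ,, s₂) ,,ᵣ D) (s₁ ,,ᵣ (s₂ ,,ᵣ D)) (As₂ {C}) (cut-right-intro α ih r e (refocus C ((s₁ ,, s₂) ,,ᵣ D) α))
cut-right-intro α ih {Γ = hole}                r (R-⊥ e) ()
cut-right-intro α ih {Γ = hole ⨾ₗ _}           r (R-⊥ e) ()
cut-right-intro α ih {Γ = (G ⨾ₗ _) ⨾ₗ _}       r (R-⊥ e) ()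
cut-right-intro α ih {Γ = (_ ⨾ᵣ G) ⨾ₗ _}       r (R-⊥ e) ()
cut-right-intro α ih {Γ = G ,,ₗ _}             r (R-⊥ e) ()
cut-right-intro α ih {Γ = _ ,,ᵣ G}             r (R-⊥ e) ()
cut-right-intro α ih {Γ = (G ,,ₗ s) ⨾ₗ t}      r (R-⊥ e) refl = R-⊥ (cut-right-intro α ih {Γ = (G ,,ₗ t) ⨾ₗ s} r e refl)
cut-right-intro α ih {Γ = (s ,,ᵣ G) ⨾ₗ t}      r (R-⊥ e) refl = R-⊥ (cut-right-intro α ih {Γ = (s ,, t) ⨾ᵣ G} r e refl)
cut-right-intro α ih {Γ = _ ⨾ᵣ G} r (R-⊥ {Δ₁} {_} {Δ₃} e) refl = R-⊥ (cut-right-intro α ih {Γ = (Δ₁ ,,ᵣ G) ⨾ₗ Δ₃} r e refl)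
cut-right-intro α ih {Γ = hole}   r (·R e₁ e₂) ()
cut-right-intro α ih {Γ = _ ⨾ₗ _} r (·R e₁ e₂) ()
cut-right-intro α ih {Γ = _ ⨾ᵣ _} r (·R e₁ e₂) ()
cut-right-intro α ih {Γ = _ ,,ₗ _} r (·R e₁ e₂) refl = ·R (cut-right-intro α ih r e₁ refl) e₂
cut-right-intro α ih {Γ = _ ,,ᵣ _} r (·R e₁ e₂) refl = ·R e₁ (cut-right-intro α ih r e₂ refl)
cut-right-intro α ih {Γ = hole}    r (∗R e₁ e₂) ()
cut-right-intro α ih {Γ = _ ,,ₗ _} r (∗R e₁ e₂) ()
cut-right-intro α ih {Γ = _ ,,ᵣ _} r (∗R e₁ e₂) ()
cut-right-intro α ih {Γ = _ ⨾ₗ _}  r (∗R e₁ e₂) refl = ∗R (cut-right-intro α ih r e₁ refl) e₂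
cut-right-intro α ih {Γ = _ ⨾ᵣ _}  r (∗R e₁ e₂) refl = ∗R e₁ (cut-right-intro α ih r e₂ refl)
cut-right-intro α ih {Γ = Γ} r (╲R {α = a} e) refl = ╲R (cut-right-intro α ih {Γ = fm a ,,ᵣ Γ} r e refl)
cut-right-intro α ih {Γ = Γ} r (⟶R {α = a} e) refl = ⟶R (cut-right-intro α ih {Γ = fm a ⨾ᵣ Γ} r e refl)
cut-right-intro α ih r (∧R e₁ e₂) refl = ∧R (cut-right-intro α ih r e₁ refl) (cut-right-intro α ih r e₂ refl)
cut-right-intro α ih r (∨R₁ e) refl = ∨R₁ (cut-right-intro α ih r e refl)
cut-right-intro α ih r (∨R₂ e) refl = ∨R₂ (cut-right-intro α ih r e refl)

-- Induction on the left premise: left and structural rules permute below the cut.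
cut-left : ∀ α → CutAdmissibleBelow α → CutAdmissible α
cut-left α ih Id e eq = subst (_⊢cf _) eq e
cut-left α ih {Γ = Γ} (·L {C} {a} {b} d) e eq = in-context Γ C (λ {G} → ·L {G} {a} {b}) (cut-left α ih d e eq)
cut-left α ih {Γ = Γ} (∗L {C} {a} {b} d) e eq = in-context Γ C (λ {G} → ∗L {G} {a} {b}) (cut-left α ih d e eq)
cut-left α ih {Γ = Γ} (╲L {C} {Δ′} {a} {b} d₁ d₂) e eq = in-context Γ C (λ {G} → ╲L {G} {Δ′} {a} {b} d₁) (cut-left α ih d₂ e eq)
cut-left α ih {Γ = Γ} (⟶L {C} {Δ′} {a} {b} d₁ d₂) e eq = in-context Γ C (λ {G} → ⟶L {G} {Δ′} {a} {b} d₁) (cut-left α ih d₂ e eq)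
cut-left α ih {Γ = Γ} (∧L₁ {C} {a} {_} {c} d) e eq = in-context Γ C (λ {G} → ∧L₁ {G} {a} {_} {c}) (cut-left α ih d e eq)
cut-left α ih {Γ = Γ} (∧L₂ {C} {a} {_} {c} d) e eq = in-context Γ C (λ {G} → ∧L₂ {G} {a} {_} {c}) (cut-left α ih d e eq)
cut-left α ih {Γ = Γ} (∨L {C} {a} {b} d₁ d₂) e eq =
  in-context² Γ C (λ {G} → ∨L {G} {a} {b}) (cut-left α ih d₁ e eq) (cut-left α ih d₂ e eq)
cut-left α ih {Γ = Γ} (⊥R {C} {Δ′} d) e eq = subst (_⊢cf _) (plug-∘ᶜ Γ C Δ′) (⊥R {Γ ∘ᶜ C} d)
cut-left α ih {Γ = Γ} (R-⊥ d) e eq = ⊥R {Γ} (R-⊥ d)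
cut-left α ih {Γ = Γ} (Ex {C} {Δ₁} {Δ₂} d) e eq = in-context Γ C (λ {G} → Ex {G} {Δ₁} {Δ₂}) (cut-left α ih d e eq)
cut-left α ih {Γ = Γ} (Ex⨾ {C} {Δ₁} {Δ₂} d) e eq = in-context Γ C (λ {G} → Ex⨾ {G} {Δ₁} {Δ₂}) (cut-left α ih d e eq)
cut-left α ih {Γ = Γ} (As₁ {C} {Δ₁} {Δ₂} {Δ₃} d) e eq = in-context Γ C (λ {G} → As₁ {G} {Δ₁} {Δ₂} {Δ₃}) (cut-left α ih d e eq)
cut-left α ih {Γ = Γ} (As₂ {C} {Δ₁} {Δ₂} {Δ₃} d) e eq = in-context Γ C (λ {G} → As₂ {G} {Δ₁} {Δ₂} {Δ₃}) (cut-left α ih d e eq)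
cut-left α ih (·R d₁ d₂) = cut-right-intro α ih (·R d₁ d₂)
cut-left α ih (∗R d₁ d₂) = cut-right-intro α ih (∗R d₁ d₂)
cut-left α ih (╲R d)     = cut-right-intro α ih (╲R d)
cut-left α ih (⟶R d)     = cut-right-intro α ih (⟶R d)
cut-left α ih (∧R d₁ d₂) = cut-right-intro α ih (∧R d₁ d₂)
cut-left α ih (∨R₁ d)    = cut-right-intro α ih (∨R₁ d)
cut-left α ih (∨R₂ d)    = cut-right-intro α ih (∨R₂ d)

cut-admissible : ∀ α → CutAdmissible α
cut-admissible α = cut-left α (below α)
  where
  below : ∀ α → CutAdmissibleBelow α
  below (a · b) ·₁ = cut-admissible a
  below (a · b) ·₂ = cut-admissible b
  below (a ∗ b) ∗₁ = cut-admissible a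
  below (a ∗ b) ∗₂ = cut-admissible b
  below (a ╲ b) ╲₁ = cut-admissible a
  below (a ╲ b) ╲₂ = cut-admissible b
  below (a ⟶ b) ⟶₁ = cut-admissible a
  below (a ⟶ b) ⟶₂ = cut-admissible b
  below (a ∧ b) ∧₁ = cut-admissible a
  below (a ∧ b) ∧₂ = cut-admissible b
  below (a ∨ b) ∨₁ = cut-admissible a
  below (a ∨ b) ∨₂ = cut-admissible b

cut-elimination : ∀ {S β} → S ⊢ β → S ⊢cf β
cut-elimination Id        = Id
cut-elimination (·L d)    = ·L (cut-elimination d)
cut-elimination (·R d e)  = ·R (cut-elimination d) (cut-elimination e)
cut-elimination (∗L d)    = ∗L (cut-elimination d)
cut-elimination (∗R d e)  = ∗R (cut-elimination d) (cut-elimination e)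
cut-elimination (╲L d e)  = ╲L (cut-elimination d) (cut-elimination e)
cut-elimination (╲R d)    = ╲R (cut-elimination d)
cut-elimination (⟶L d e)  = ⟶L (cut-elimination d) (cut-elimination e)
cut-elimination (⟶R d)    = ⟶R (cut-elimination d)
cut-elimination (∧L₁ d)   = ∧L₁ (cut-elimination d)
cut-elimination (∧L₂ d)   = ∧L₂ (cut-elimination d)
cut-elimination (∧R d e)  = ∧R (cut-elimination d) (cut-elimination e)
cut-elimination (∨L d e)  = ∨L (cut-elimination d) (cut-elimination e)
cut-elimination (∨R₁ d)   = ∨R₁ (cut-elimination d)
cut-elimination (∨R₂ d)   = ∨R₂ (cut-elimination d)
cut-elimination (⊥R d)    = ⊥R (cut-elimination d)
cut-elimination (Cut {α = α} d e) = cut-admissible α (cut-elimination d) (cut-elimination e) refl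
cut-elimination (R-⊥ d)   = R-⊥ (cut-elimination d)
cut-elimination (Ex d)    = Ex (cut-elimination d)
cut-elimination (Ex⨾ d)   = Ex⨾ (cut-elimination d)
cut-elimination (As₁ d)   = As₁ (cut-elimination d)
cut-elimination (As₂ d)   = As₂ (cut-elimination d)

data Code : Set where
  leaf : ℕ → Code
  node : ℕ → Code → Code → Code

_≟ᶜ_ : DecidableEquality Code
leaf m ≟ᶜ leaf n = map′ (cong leaf) (λ { refl → refl }) (m ℕ.≟ n)
node i l r ≟ᶜ node j l′ r′ =
  map′ (λ { (refl , refl , refl) → refl }) (λ { refl → refl , refl , refl })
       (i ℕ.≟ j ×-dec l ≟ᶜ l′ ×-dec r ≟ᶜ r′)
leaf _ ≟ᶜ node _ _ _ = no λ ()
node _ _ _ ≟ᶜ leaf _ = no λ ()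

encode : Fm → Code
encode (var n) = leaf (suc n)
encode ⊥f      = leaf zero
encode (a · b) = node 0 (encode a) (encode b)
encode (a ╲ b) = node 1 (encode a) (encode b)
encode (a ∧ b) = node 2 (encode a) (encode b)
encode (a ∨ b) = node 3 (encode a) (encode b)
encode (a ∗ b) = node 4 (encode a) (encode b)
encode (a ⟶ b) = node 5 (encode a) (encode b)

decode : Code → Fm
decode (leaf zero)    = ⊥f
decode (leaf (suc n)) = var n
decode (node 0 l r)   = decode l · decode r
decode (node 1 l r)   = decode l ╲ decode r
decode (node 2 l r)   = decode l ∧ decode r
decode (node 3 l r)   = decode l ∨ decode r
decode (node 4 l r)   = decode l ∗ decode r
decode (node 5 l r)   = decode l ⟶ decode r
decode (node _ _ _)   = ⊥f

decode-encode : ∀ f → decode (encode f) ≡ f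
decode-encode (var n) = refl
decode-encode ⊥f      = refl
decode-encode (a · b) = cong₂ _·_ (decode-encode a) (decode-encode b)
decode-encode (a ╲ b) = cong₂ _╲_ (decode-encode a) (decode-encode b)
decode-encode (a ∧ b) = cong₂ _∧_ (decode-encode a) (decode-encode b)
decode-encode (a ∨ b) = cong₂ _∨_ (decode-encode a) (decode-encode b)
decode-encode (a ∗ b) = cong₂ _∗_ (decode-encode a) (decode-encode b)
decode-encode (a ⟶ b) = cong₂ _⟶_ (decode-encode a) (decode-encode b)

_≟_ : DecidableEquality Fm
a ≟ b = map′ injective (cong encode) (encode a ≟ᶜ encode b)
  where
  injective : encode a ≡ encode b → a ≡ b
  injective eq = trans (sym (decode-encode a)) (trans (cong decode eq) (decode-encode b))

subformulas properSubformulas : Fm → List Fm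
subformulas f = f ∷ properSubformulas f
properSubformulas (var _) = []
properSubformulas ⊥f      = []
properSubformulas (a · b) = subformulas a ++ subformulas b
properSubformulas (a ╲ b) = subformulas a ++ subformulas b
properSubformulas (a ∧ b) = subformulas a ++ subformulas b
properSubformulas (a ∨ b) = subformulas a ++ subformulas b
properSubformulas (a ∗ b) = subformulas a ++ subformulas b
properSubformulas (a ⟶ b) = subformulas a ++ subformulas b

-- Occurrences are counted with multiplicity, so the length of this list is the weight of a structure.
subformulasˢ : Str → List Fm
subformulasˢ (fm f)   = subformulas f
subformulasˢ (A ,, B) = subformulasˢ A ++ subformulasˢ B
subformulasˢ (A ⨾ B)  = subformulasˢ A ++ subformulasˢ B

subformulasˢ-nonempty : ∀ S → 0 < length (subformulasˢ S)
subformulasˢ-nonempty (fm f)   = s≤s z≤n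
subformulasˢ-nonempty (A ,, B) = ≤-trans (subformulasˢ-nonempty A) (length-++-≤ˡ (subformulasˢ A))
subformulasˢ-nonempty (A ⨾ B)  = ≤-trans (subformulasˢ-nonempty A) (length-++-≤ˡ (subformulasˢ A))

infix 4 _≲_ _⊑_ _≼_

record _≲_ (xs ys : List Fm) : Set where
  constructor _&_
  field
    shorter : length xs ≤ length ys
    within  : xs ⊆ ys

≲-refl : ∀ {xs} → xs ≲ xs
≲-refl = ≤-refl & ⊆-refl

≲-trans : ∀ {xs ys zs} → xs ≲ ys → ys ≲ zs → xs ≲ zs
≲-trans (l₁ & s₁) (l₂ & s₂) = ≤-trans l₁ l₂ & ⊆-trans s₁ s₂

≲-reflexive-↭ : ∀ {xs ys} → xs ↭ ys → xs ≲ ys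
≲-reflexive-↭ p = ≤-reflexive (↭-length p) & ⊆-reflexive-↭ p

≲-∷ : ∀ {x xs ys} → xs ≲ ys → x ∷ xs ≲ x ∷ ys
≲-∷ {x} (l & s) = s≤s l & ∷⁺ʳ x s

≲-++ : ∀ {xs xs′ ys ys′} → xs ≲ xs′ → ys ≲ ys′ → xs ++ ys ≲ xs′ ++ ys′
≲-++ {xs} {xs′} {ys} {ys′} (l₁ & s₁) (l₂ & s₂) =
    ≤-trans (≤-reflexive (length-++ xs {ys})) (≤-trans (+-mono-≤ l₁ l₂) (≤-reflexive (sym (length-++ xs′ {ys′}))))
  & ⊆-++⁺ s₁ s₂

≲-∷-tail : ∀ {x xs} → xs ≲ x ∷ xs
≲-∷-tail {x} {xs} = n≤1+n _ & xs⊆x∷xs xs x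

≲-++ˡ : ∀ xs ys → xs ≲ xs ++ ys
≲-++ˡ xs ys = length-++-≤ˡ xs & xs⊆xs++ys xs ys

≲-++ʳ : ∀ xs ys → ys ≲ xs ++ ys
≲-++ʳ xs ys = length-++-≤ʳ ys {xs} & xs⊆ys++xs ys xs

record _⊑_ (Y X : Str) : Set where
  constructor ⊑⟨_⟩
  field
    subformulas≲ : subformulasˢ Y ≲ subformulasˢ X

open _⊑_

⊑-trans : ∀ {X Y Z} → X ⊑ Y → Y ⊑ Z → X ⊑ Z
⊑-trans ⊑⟨ p ⟩ ⊑⟨ q ⟩ = ⊑⟨ ≲-trans p q ⟩

⊑-↭ : ∀ Y X → subformulasˢ Y ↭ subformulasˢ X → Y ⊑ X
⊑-↭ _ _ p = ⊑⟨ ≲-reflexive-↭ p ⟩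

⊑-,, : ∀ {A A′ B B′} → A ⊑ A′ → B ⊑ B′ → (A ,, B) ⊑ (A′ ,, B′)
⊑-,, ⊑⟨ p ⟩ ⊑⟨ q ⟩ = ⊑⟨ ≲-++ p q ⟩

⊑-,,-⨾ : ∀ {A B} → (A ,, B) ⊑ (A ⨾ B)
⊑-,,-⨾ = ⊑⟨ ≲-refl ⟩

⊑-plug : ∀ C {X Y} → Y ⊑ X → C [ Y ] ⊑ C [ X ]
⊑-plug hole      p = p
⊑-plug (C ,,ₗ _) p = ⊑⟨ ≲-++ (subformulas≲ (⊑-plug C p)) ≲-refl ⟩
⊑-plug (_ ,,ᵣ C) p = ⊑⟨ ≲-++ ≲-refl (subformulas≲ (⊑-plug C p)) ⟩
⊑-plug (C ⨾ₗ _)  p = ⊑⟨ ≲-++ (subformulas≲ (⊑-plug C p)) ≲-refl ⟩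
⊑-plug (_ ⨾ᵣ C)  p = ⊑⟨ ≲-++ ≲-refl (subformulas≲ (⊑-plug C p)) ⟩

⊑-plugged : ∀ C X → X ⊑ C [ X ]
⊑-plugged hole      X = ⊑⟨ ≲-refl ⟩
⊑-plugged (C ,,ₗ Σ) X = ⊑-trans (⊑-plugged C X) ⊑⟨ ≲-++ˡ (subformulasˢ (C [ X ])) (subformulasˢ Σ) ⟩
⊑-plugged (Σ ,,ᵣ C) X = ⊑-trans (⊑-plugged C X) ⊑⟨ ≲-++ʳ (subformulasˢ Σ) (subformulasˢ (C [ X ])) ⟩
⊑-plugged (C ⨾ₗ Σ)  X = ⊑-trans (⊑-plugged C X) ⊑⟨ ≲-++ˡ (subformulasˢ (C [ X ])) (subformulasˢ Σ) ⟩
⊑-plugged (Σ ⨾ᵣ C)  X = ⊑-trans (⊑-plugged C X) ⊑⟨ ≲-++ʳ (subformulasˢ Σ) (subformulasˢ (C [ X ])) ⟩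

⊑-proper : ∀ Y {c} → subformulasˢ Y ≡ properSubformulas c → Y ⊑ fm c
⊑-proper Y eq = ⊑⟨ ≲-trans (≲-reflexive-↭ (↭-reflexive eq)) ≲-∷-tail ⟩

⊑-≺ : ∀ {a b} → a ≺ b → fm a ⊑ fm b
⊑-≺ p = ⊑⟨ ≲-trans (proper p) ≲-∷-tail ⟩
  where
  proper : ∀ {a b} → a ≺ b → subformulas a ≲ properSubformulas b
  proper (·₁ {a} {b}) = ≲-++ˡ (subformulas a) (subformulas b)
  proper (·₂ {a} {b}) = ≲-++ʳ (subformulas a) (subformulas b)
  proper (∗₁ {a} {b}) = ≲-++ˡ (subformulas a) (subformulas b)
  proper (∗₂ {a} {b}) = ≲-++ʳ (subformulas a) (subformulas b)
  proper (╲₁ {a} {b}) = ≲-++ˡ (subformulas a) (subformulas b)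
  proper (╲₂ {a} {b}) = ≲-++ʳ (subformulas a) (subformulas b)
  proper (⟶₁ {a} {b}) = ≲-++ˡ (subformulas a) (subformulas b)
  proper (⟶₂ {a} {b}) = ≲-++ʳ (subformulas a) (subformulas b)
  proper (∧₁ {a} {b}) = ≲-++ˡ (subformulas a) (subformulas b)
  proper (∧₂ {a} {b}) = ≲-++ʳ (subformulas a) (subformulas b)
  proper (∨₁ {a} {b}) = ≲-++ˡ (subformulas a) (subformulas b)
  proper (∨₂ {a} {b}) = ≲-++ʳ (subformulas a) (subformulas b)

Sequent : Set
Sequent = Str × Fm

Provable : Sequent → Set
Provable (S , β) = S ⊢ β

-- ⊥f is included because the rule ⊥R introduces it into premises.
support : Sequent → List Fm
support (S , β) = ⊥f ∷ subformulasˢ S ++ subformulas β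

record _≼_ (p s : Sequent) : Set where
  constructor ≼⟨_⟩
  field
    support≲ : support p ≲ support s

≼-refl : ∀ {s} → s ≼ s
≼-refl = ≼⟨ ≲-refl ⟩

≼-trans : ∀ {p q s} → p ≼ q → q ≼ s → p ≼ s
≼-trans ≼⟨ p ⟩ ≼⟨ q ⟩ = ≼⟨ ≲-trans p q ⟩

≼-⊑ : ∀ {S β S′ β′} → (S ,, fm β) ⊑ (S′ ,, fm β′) → (S , β) ≼ (S′ , β′)
≼-⊑ ⊑⟨ p ⟩ = ≼⟨ ≲-∷ p ⟩

≼-plug : ∀ C β {X Y} → Y ⊑ X → (C [ Y ] , β) ≼ (C [ X ] , β)
≼-plug C β p = ≼-⊑ (⊑-plug (C ,,ₗ fm β) p)

≼-⊥-succedent : ∀ S β → (S , ⊥f) ≼ (S , β)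
≼-⊥-succedent S β = ≼⟨ s≤s shorter & within ⟩
  where
  shorter : length (subformulasˢ S ++ ⊥f ∷ []) ≤ length (subformulasˢ S ++ subformulas β)
  shorter = ≤-trans (≤-reflexive (length-++ (subformulasˢ S)))
              (≤-trans (+-monoʳ-≤ (length (subformulasˢ S)) (s≤s z≤n)) (≤-reflexive (sym (length-++ (subformulasˢ S)))))
  within : ⊥f ∷ subformulasˢ S ++ ⊥f ∷ [] ⊆ ⊥f ∷ subformulasˢ S ++ subformulas β
  within (here refl) = here refl
  within (there x∈) with ∈-++⁻ (subformulasˢ S) x∈
  ... | inj₁ x∈S         = there (∈-++⁺ˡ x∈S)
  ... | inj₂ (here refl) = here refl

≼-⊥R : ∀ C X β → (X , ⊥f) ≼ (C [ X ] , β)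
≼-⊥R C X β = ≼-trans (≼-⊥-succedent X β) (≼-⊑ (⊑-plug (hole ,,ₗ fm β) (⊑-plugged C X)))

record Instance (s : Sequent) : Set where
  field
    premises : List Sequent
    sound    : All Provable premises → Provable s
    bounded  : All (_≼ s) premises

open Instance

axiom : ∀ {s} → Provable s → Instance s
axiom d = record { premises = [] ; sound = λ _ → d ; bounded = [] }

unary : ∀ {s} p → (Provable p → Provable s) → p ≼ s → Instance s
unary p rule p≼s = record { premises = p ∷ [] ; sound = λ { (d ∷ []) → rule d } ; bounded = p≼s ∷ [] }

binary : ∀ {s} p q → (Provable p → Provable q → Provable s) → p ≼ s → q ≼ s → Instance s
binary p q rule p≼s q≼s =
  record { premises = p ∷ q ∷ [] ; sound = λ { (d ∷ e ∷ []) → rule d e } ; bounded = p≼s ∷ q≼s ∷ [] }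

logicalAt : ∀ C X β → List (Instance (C [ X ] , β))
logicalAt C (fm (a · b)) β = unary (C [ fm a ,, fm b ] , β) (·L {C}) (≼-plug C β (⊑-proper (fm a ,, fm b) refl)) ∷ []
logicalAt C (fm (a ∗ b)) β = unary (C [ fm a ⨾ fm b ] , β) (∗L {C}) (≼-plug C β (⊑-proper (fm a ⨾ fm b) refl)) ∷ []
logicalAt C (fm (a ∧ c)) β =
  unary (C [ fm a ] , β) (∧L₁ {C}) (≼-plug C β (⊑-≺ ∧₁)) ∷
  unary (C [ fm c ] , β) (∧L₂ {C}) (≼-plug C β (⊑-≺ ∧₂)) ∷ []
logicalAt C (fm (a ∨ b)) β =
  binary (C [ fm a ] , β) (C [ fm b ] , β) (∨L {C}) (≼-plug C β (⊑-≺ ∨₁)) (≼-plug C β (⊑-≺ ∨₂)) ∷ []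
logicalAt C (Δ ,, fm (a ╲ b)) β =
  binary (Δ , a) (C [ fm b ] , β) (╲L {C})
    (≼-⊑ (⊑-trans (⊑-plug (Δ ,,ᵣ hole) (⊑-≺ ╲₁)) (⊑-plugged (C ,,ₗ fm β) (Δ ,, fm (a ╲ b)))))
    (≼-plug C β (⊑-trans (⊑-≺ ╲₂) (⊑-plugged (Δ ,,ᵣ hole) (fm (a ╲ b))))) ∷ []
logicalAt C (Δ ⨾ fm (a ⟶ b)) β =
  binary (Δ , a) (C [ fm b ] , β) (⟶L {C})
    (≼-⊑ (⊑-trans (⊑-plug (Δ ,,ᵣ hole) (⊑-≺ ⟶₁))
           (⊑-trans ⊑-,,-⨾ (⊑-plugged (C ,,ₗ fm β) (Δ ⨾ fm (a ⟶ b))))))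
    (≼-plug C β (⊑-trans (⊑-≺ ⟶₂) (⊑-plugged (Δ ⨾ᵣ hole) (fm (a ⟶ b))))) ∷ []
logicalAt C _ β = []

exchangeAt : ∀ C X β → List (Instance (C [ X ] , β))
exchangeAt C (A ,, B) β =
  unary (C [ B ,, A ] , β) (Ex {C}) (≼-plug C β (⊑-↭ (B ,, A) (A ,, B) (++-comm (subformulasˢ B) (subformulasˢ A)))) ∷ []
exchangeAt C (A ⨾ B)  β =
  unary (C [ B ⨾ A ] , β) (Ex⨾ {C}) (≼-plug C β (⊑-↭ (B ⨾ A) (A ⨾ B) (++-comm (subformulasˢ B) (subformulasˢ A)))) ∷ []
exchangeAt C (fm _)   β = []

assoc₁At : ∀ C X β → List (Instance (C [ X ] , β))
assoc₁At C ((A ,, B) ,, D) β =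
  unary (C [ A ,, (B ,, D) ] , β) (As₁ {C}) (≼-plug C β (⊑-↭ (A ,, (B ,, D)) ((A ,, B) ,, D)
    (↭-reflexive (sym (++-assoc (subformulasˢ A) (subformulasˢ B) (subformulasˢ D)))))) ∷ []
assoc₁At C _ β = []

assoc₂At : ∀ C X β → List (Instance (C [ X ] , β))
assoc₂At C (A ,, (B ,, D)) β =
  unary (C [ (A ,, B) ,, D ] , β) (As₂ {C}) (≼-plug C β (⊑-↭ ((A ,, B) ,, D) (A ,, (B ,, D))
    (↭-reflexive (++-assoc (subformulasˢ A) (subformulasˢ B) (subformulasˢ D))))) ∷ []
assoc₂At C _ β = []

instancesAt : ∀ C X β → List (Instance (C [ X ] , β))
instancesAt C X β =
  unary (X , ⊥f) (⊥R {C}) (≼-⊥R C X β) ∷ logicalAt C X β ++ exchangeAt C X β ++ assoc₁At C X β ++ assoc₂At C X β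

identityAt : ∀ S β → List (Instance (S , β))
identityAt (fm f) β = identityIf (f ≟ β)
  where
  identityIf : Dec (f ≡ β) → List (Instance (fm f , β))
  identityIf (yes refl) = axiom Id ∷ []
  identityIf (no _)     = []
identityAt _ _ = []

rightAt : ∀ β S → List (Instance (S , β))
rightAt (a · b) (A ,, B) =
  binary (A , a) (B , b) ·R
    (≼-⊑ (⊑-,, (⊑-plugged (hole ,,ₗ B) A) (⊑-≺ ·₁)))
    (≼-⊑ (⊑-,, (⊑-plugged (A ,,ᵣ hole) B) (⊑-≺ ·₂))) ∷ []
rightAt (a ∗ b) (A ⨾ B) =
  binary (A , a) (B , b) ∗R
    (≼-⊑ (⊑-,, (⊑-plugged (hole ⨾ₗ B) A) (⊑-≺ ∗₁)))
    (≼-⊑ (⊑-,, (⊑-plugged (A ⨾ᵣ hole) B) (⊑-≺ ∗₂))) ∷ []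
rightAt (a ╲ b) S =
  unary (fm a ,, S , b) ╲R (≼-⊑ (⊑-trans
    (⊑-↭ ((fm a ,, S) ,, fm b) (S ,, (fm a ,, fm b)) (↭-rotate (subformulas a) (subformulasˢ S) (subformulas b)))
    (⊑-plug (S ,,ᵣ hole) (⊑-proper (fm a ,, fm b) refl)))) ∷ []
rightAt (a ⟶ b) S =
  unary (fm a ⨾ S , b) ⟶R (≼-⊑ (⊑-trans
    (⊑-↭ ((fm a ⨾ S) ,, fm b) (S ,, (fm a ,, fm b)) (↭-rotate (subformulas a) (subformulasˢ S) (subformulas b)))
    (⊑-plug (S ,,ᵣ hole) (⊑-proper (fm a ,, fm b) refl)))) ∷ []
rightAt (a ∧ b) S =
  binary (S , a) (S , b) ∧R
    (≼-⊑ (⊑-plug (S ,,ᵣ hole) (⊑-≺ ∧₁))) (≼-⊑ (⊑-plug (S ,,ᵣ hole) (⊑-≺ ∧₂))) ∷ []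
rightAt (a ∨ b) S =
  unary (S , a) ∨R₁ (≼-⊑ (⊑-plug (S ,,ᵣ hole) (⊑-≺ ∨₁))) ∷
  unary (S , b) ∨R₂ (≼-⊑ (⊑-plug (S ,,ᵣ hole) (⊑-≺ ∨₂))) ∷ []
rightAt ⊥f ((A ,, B) ⨾ D) =
  unary ((A ,, D) ⨾ B , ⊥f) R-⊥ (≼-⊑ (⊑-plug (hole ,,ₗ fm ⊥f)
    (⊑-↭ ((A ,, D) ⨾ B) ((A ,, B) ⨾ D) (↭-swap-tail (subformulasˢ A) (subformulasˢ D) (subformulasˢ B))))) ∷ []
rightAt _ _ = []

Splitting : Str → Set
Splitting S = Σ Ctx λ C → Σ Str λ X → C [ X ] ≡ S

splitting-,,ₗ : ∀ {A} B → Splitting A → Splitting (A ,, B)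
splitting-,,ₗ B (C , X , eq) = C ,,ₗ B , X , cong (_,, B) eq

splitting-,,ᵣ : ∀ A {B} → Splitting B → Splitting (A ,, B)
splitting-,,ᵣ A (C , X , eq) = A ,,ᵣ C , X , cong (A ,,_) eq

splitting-⨾ₗ : ∀ {A} B → Splitting A → Splitting (A ⨾ B)
splitting-⨾ₗ B (C , X , eq) = C ⨾ₗ B , X , cong (_⨾ B) eq

splitting-⨾ᵣ : ∀ A {B} → Splitting B → Splitting (A ⨾ B)
splitting-⨾ᵣ A (C , X , eq) = A ⨾ᵣ C , X , cong (A ⨾_) eq

splittings : (S : Str) → List (Splitting S)
splittings S = (hole , S , refl) ∷ proper S
  where
  proper : (S : Str) → List (Splitting S)
  proper (fm _)   = []
  proper (A ,, B) = map (splitting-,,ₗ B) (splittings A) ++ map (splitting-,,ᵣ A) (splittings B)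
  proper (A ⨾ B)  = map (splitting-⨾ₗ B) (splittings A) ++ map (splitting-⨾ᵣ A) (splittings B)

∈-splittings : ∀ C X → (C , X , refl) ∈ splittings (C [ X ])
∈-splittings hole      X = here refl
∈-splittings (C ,,ₗ B) X = there (∈-++⁺ˡ (∈-map⁺ (splitting-,,ₗ B) (∈-splittings C X)))
∈-splittings (A ,,ᵣ C) X =
  there (∈-++⁺ʳ (map (splitting-,,ₗ (C [ X ])) (splittings A)) (∈-map⁺ (splitting-,,ᵣ A) (∈-splittings C X)))
∈-splittings (C ⨾ₗ B)  X = there (∈-++⁺ˡ (∈-map⁺ (splitting-⨾ₗ B) (∈-splittings C X)))
∈-splittings (A ⨾ᵣ C)  X =
  there (∈-++⁺ʳ (map (splitting-⨾ₗ (C [ X ])) (splittings A)) (∈-map⁺ (splitting-⨾ᵣ A) (∈-splittings C X)))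

instancesAtSplitting : ∀ {S} β → Splitting S → List (Instance (S , β))
instancesAtSplitting β (C , X , refl) = instancesAt C X β

instances : (s : Sequent) → List (Instance s)
instances (S , β) = concatMap (instancesAtSplitting β) (splittings S) ++ identityAt S β ++ rightAt β S

∈-instances-at : ∀ C X β {r} → r ∈ instancesAt C X β → r ∈ instances (C [ X ] , β)
∈-instances-at C X β r∈ =
  ∈-++⁺ˡ (∈-concatMap⁺ (instancesAtSplitting β) (Any.map (λ { refl → r∈ }) (∈-splittings C X)))

∈-instances-root : ∀ {S β r} → r ∈ identityAt S β ++ rightAt β S → r ∈ instances (S , β)
∈-instances-root {S} {β} r∈ = ∈-++⁺ʳ (concatMap (instancesAtSplitting β) (splittings S)) r∈

open Saturation premises instances

identity-instance : ∀ α → axiom Id ∈ identityAt (fm α) α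
identity-instance α with α ≟ α
... | yes refl = here refl
... | no ¬refl = contradiction refl ¬refl

derivable-complete : ∀ {S β} → S ⊢cf β → ∃ λ k → Derivable k (S , β)
derivable-complete (Id {α}) = derivable-by (∈-instances-root (∈-++⁺ˡ (identity-instance α))) []
derivable-complete {β = β} (·L {C} {a} {b} d) =
  derivable-by (∈-instances-at C (fm (a · b)) β (there (here refl))) (derivable-complete d ∷ [])
derivable-complete {β = β} (∗L {C} {a} {b} d) =
  derivable-by (∈-instances-at C (fm (a ∗ b)) β (there (here refl))) (derivable-complete d ∷ [])
derivable-complete {β = β} (∧L₁ {C} {a} {_} {c} d) =
  derivable-by (∈-instances-at C (fm (a ∧ c)) β (there (here refl))) (derivable-complete d ∷ [])
derivable-complete {β = β} (∧L₂ {C} {a} {_} {c} d) =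
  derivable-by (∈-instances-at C (fm (c ∧ a)) β (there (there (here refl)))) (derivable-complete d ∷ [])
derivable-complete {β = β} (∨L {C} {a} {b} d e) =
  derivable-by (∈-instances-at C (fm (a ∨ b)) β (there (here refl)))
    (derivable-complete d ∷ derivable-complete e ∷ [])
derivable-complete {β = β} (╲L {C} {Δ} {a} {b} d e) =
  derivable-by (∈-instances-at C (Δ ,, fm (a ╲ b)) β (there (here refl)))
    (derivable-complete d ∷ derivable-complete e ∷ [])
derivable-complete {β = β} (⟶L {C} {Δ} {a} {b} d e) =
  derivable-by (∈-instances-at C (Δ ⨾ fm (a ⟶ b)) β (there (here refl)))
    (derivable-complete d ∷ derivable-complete e ∷ [])
derivable-complete {β = β} (⊥R {C} {Δ} d) =
  derivable-by (∈-instances-at C Δ β (here refl)) (derivable-complete d ∷ [])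
derivable-complete {β = β} (Ex {C} {A} {B} d) =
  derivable-by (∈-instances-at C (B ,, A) β (there (∈-++⁺ʳ (logicalAt C (B ,, A) β) (here refl))))
    (derivable-complete d ∷ [])
derivable-complete {β = β} (Ex⨾ {C} {A} {B} d) =
  derivable-by (∈-instances-at C (B ⨾ A) β (there (∈-++⁺ʳ (logicalAt C (B ⨾ A) β) (here refl))))
    (derivable-complete d ∷ [])
derivable-complete {β = β} (As₁ {C} {A} {B} {D} d) =
  derivable-by (∈-instances-at C X β (there (∈-++⁺ʳ (logicalAt C X β) (∈-++⁺ʳ (exchangeAt C X β) (here refl)))))
    (derivable-complete d ∷ [])
  where
  X : Str
  X = (A ,, B) ,, D
derivable-complete {β = β} (As₂ {C} {A} {B} {D} d) =
  derivable-by (∈-instances-at C X β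
    (there (∈-++⁺ʳ (logicalAt C X β) (∈-++⁺ʳ (exchangeAt C X β) (∈-++⁺ʳ (assoc₁At C X β) (here refl))))))
    (derivable-complete d ∷ [])
  where
  X : Str
  X = A ,, (B ,, D)
derivable-complete (·R {A} {B} {a} {b} d e) =
  derivable-by (∈-instances-root (∈-++⁺ʳ (identityAt (A ,, B) (a · b)) (here refl)))
    (derivable-complete d ∷ derivable-complete e ∷ [])
derivable-complete (∗R {A} {B} {a} {b} d e) =
  derivable-by (∈-instances-root (∈-++⁺ʳ (identityAt (A ⨾ B) (a ∗ b)) (here refl)))
    (derivable-complete d ∷ derivable-complete e ∷ [])
derivable-complete (╲R {S} {a} {b} d) =
  derivable-by (∈-instances-root (∈-++⁺ʳ (identityAt S (a ╲ b)) (here refl))) (derivable-complete d ∷ [])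
derivable-complete (⟶R {S} {a} {b} d) =
  derivable-by (∈-instances-root (∈-++⁺ʳ (identityAt S (a ⟶ b)) (here refl))) (derivable-complete d ∷ [])
derivable-complete (∧R {S} {a} {b} d e) =
  derivable-by (∈-instances-root (∈-++⁺ʳ (identityAt S (a ∧ b)) (here refl)))
    (derivable-complete d ∷ derivable-complete e ∷ [])
derivable-complete (∨R₁ {S} {a} {b} d) =
  derivable-by (∈-instances-root (∈-++⁺ʳ (identityAt S (a ∨ b)) (here refl))) (derivable-complete d ∷ [])
derivable-complete (∨R₂ {S} {b} {a} d) =
  derivable-by (∈-instances-root (∈-++⁺ʳ (identityAt S (a ∨ b)) (there (here refl)))) (derivable-complete d ∷ [])
derivable-complete (R-⊥ {A} {D} {B} d) =
  derivable-by (∈-instances-root (∈-++⁺ʳ (identityAt ((A ,, B) ⨾ D) ⊥f) (here refl))) (derivable-complete d ∷ [])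

joins : Str × Str → List Str
joins (A , B) = (A ,, B) ∷ (A ⨾ B) ∷ []

structures : List Fm → ℕ → List Str
structures F zero    = []
structures F (suc n) = map fm F ++ concatMap joins (cartesianProduct (structures F n) (structures F n))

∈-joins : ∀ {F n A B S} → S ∈ joins (A , B) → A ∈ structures F n → B ∈ structures F n
        → S ∈ structures F (suc n)
∈-joins {F} S∈ A∈ B∈ =
  ∈-++⁺ʳ (map fm F) (∈-concatMap⁺ joins (Any.map (λ { refl → S∈ }) (∈-cartesianProduct⁺ A∈ B∈)))

parts-shorter : ∀ A B {n} → length (subformulasˢ A ++ subformulasˢ B) ≤ suc n
              → length (subformulasˢ A) ≤ n × length (subformulasˢ B) ≤ n
parts-shorter A B short =
    s≤s⁻¹ (<-≤-trans (m<m+n _ (subformulasˢ-nonempty B)) total)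
  , s≤s⁻¹ (<-≤-trans (m<n+m _ (subformulasˢ-nonempty A)) total)
  where
  total : length (subformulasˢ A) + length (subformulasˢ B) ≤ suc _
  total = ≤-trans (≤-reflexive (sym (length-++ (subformulasˢ A)))) short

∈-structures : ∀ {F} n S → length (subformulasˢ S) ≤ n → subformulasˢ S ⊆ F → S ∈ structures F n
∈-structures zero S short _ = contradiction (≤-trans (subformulasˢ-nonempty S) short) λ ()
∈-structures (suc n) (fm f) _ sub = ∈-++⁺ˡ (∈-map⁺ fm (sub (here refl)))
∈-structures {F} (suc n) (A ,, B) short sub with parts-shorter A B short
... | shortA , shortB = ∈-joins {F} {n} (here refl)
  (∈-structures n A shortA (sub ∘ ∈-++⁺ˡ)) (∈-structures n B shortB (sub ∘ ∈-++⁺ʳ (subformulasˢ A)))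
∈-structures {F} (suc n) (A ⨾ B) short sub with parts-shorter A B short
... | shortA , shortB = ∈-joins {F} {n} (there (here refl))
  (∈-structures n A shortA (sub ∘ ∈-++⁺ˡ)) (∈-structures n B shortB (sub ∘ ∈-++⁺ʳ (subformulasˢ A)))

universe : Sequent → List Sequent
universe s₀ = cartesianProduct (structures (support s₀) (length (support s₀))) (support s₀)

∈-universe : ∀ s₀ {s} → s ≼ s₀ → s ∈ universe s₀
∈-universe s₀ {S , β} ≼⟨ short & sub ⟩ =
  ∈-cartesianProduct⁺ (∈-structures {support s₀} (length (support s₀)) S shortS (sub ∘ there ∘ ∈-++⁺ˡ))
                      (sub (there (∈-++⁺ʳ (subformulasˢ S) (here refl))))
  where
  shortS : length (subformulasˢ S) ≤ length (support s₀)
  shortS = ≤-trans (m≤n⇒m≤1+n (length-++-≤ˡ (subformulasˢ S))) short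

bounded-by : ∀ s₀ {s} → s ≼ s₀ → (r : Instance s) → All (_≼ s₀) (premises r)
bounded-by s₀ s≼s₀ r = All.map (λ p≼s → ≼-trans p≼s s≼s₀) (bounded r)

theorem6 : (Γ : Str) (α : Fm) → Dec (Γ ⊢ α)
theorem6 Γ α = map′ sound-at complete-at (derivable? k (Γ , α))
  where
  open Stabilisation (bounded-by (Γ , α)) (universe (Γ , α)) (∈-universe (Γ , α))

  k : ℕ
  k = proj₁ stable-exists

  sound-at : Derivable k (Γ , α) → Γ ⊢ α
  sound-at = Derivable-sound Provable sound k

  complete-at : Γ ⊢ α → Derivable k (Γ , α)
  complete-at p with derivable-complete (cut-elimination p)
  ... | m , d = stable-forever (proj₂ stable-exists) m ≼-refl d
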